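{- Let $G=([n],E)$ be a graph and $D\in\mathbb{R}^{n\times n}$ an arbitrary diagonal matrix, and let $k$ be a positive integer with $\mathrm{girth}(G)>k$. Then for any two signings $s_1,s_2$ of $G$ and every $i=1,\dots,k$, \[ e_i\big(\boldsymbol\lambda(D+A_{s_1})\big)=e_i\big(\boldsymbol\lambda(D+A_{s_2})\big);\] that is, the top $k$ coefficients of $\det(xI-(D+A_s))$ do not depend on the signing $s$.
   Context: $\mathrm{girth}(G)$ is the length of the shortest cycle in $G$ ($\infty$ if $G$ is a forest). A signing of $G$ is any function $s:E\to\{ -1,+1\}$; its signed adjacency matrix $A_s\in\mathbb{R}^{n\times n}$ has $A_s(u,v)=s(\{u,v\})$ if $\{u,v\}\in E$ and $A_s(u,v)=0$ otherwise. For a symmetric matrix $M$, $\boldsymbol\lambda(M)\in\mathbb{R}^n$ is the vector of its eigenvalues (the roots of $\det(xI-M)$ with multiplicity), and for $\boldsymbol\mu\in\mathbb{R}^n$, $e_i(\boldsymbol\mu)=\sum_{T\subseteq[n],|T|=i}\prod_{j\in T}\mu_j$. -}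

module Defs where

open import Level using (Level; _⊔_)
open import Data.Bool using (Bool; true; false; if_then_else_)
open import Data.Nat using (ℕ; zero; suc; _≤_; _<_; _∸_; _≤ᵇ_)
open import Data.Fin using (Fin; zero; suc; inject₁; fromℕ; punchIn; _≟_)
open import Data.List using (List; []; _∷_; map)
open import Data.Sign using (Sign)
open import Function.Definitions using (Injective)
open import Relation.Binary.PropositionalEquality using (_≡_)
open import Relation.Nullary using (yes; no)
open import Algebra.Bundles using (CommutativeRing)

record Graph (n : ℕ) : Set where
  field
    adj     : Fin n → Fin n → Bool
    adj-sym : ∀ u v → adj u v ≡ adj v u
    irrefl  : ∀ v → adj v v ≡ false
open Graph public

-- A cycle of length (suc m) ≥ 3: distinct vertices vs 0, …, vs m with
-- vs i ~ vs (i+1) and vs m ~ vs 0.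
record Cycle {n : ℕ} (G : Graph n) (m : ℕ) : Set where
  field
    len≥3   : 2 ≤ m
    vs      : Fin (suc m) → Fin n
    distinct : Injective _≡_ _≡_ vs
    step    : ∀ (i : Fin m) → adj G (vs (inject₁ i)) (vs (suc i)) ≡ true
    close   : adj G (vs (fromℕ m)) (vs zero) ≡ true

-- girth(G) > k : every cycle has length > k (vacuous for forests, girth = ∞)
GirthGreaterThan : ∀ {n} → Graph n → ℕ → Set
GirthGreaterThan G k = ∀ m → Cycle G m → k < suc m

-- A signing of G: a ±1 value on each (unordered) edge, i.e. a symmetric
-- function on pairs of vertices (values on non-edges are irrelevant).
record Signing {n : ℕ} (G : Graph n) : Set where
  field
    sgn     : Fin n → Fin n → Sign
    sgn-sym : ∀ u v → sgn u v ≡ sgn v u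
open Signing public

module _ {c ℓ : Level} (R : CommutativeRing c ℓ) where
  open CommutativeRing R renaming (Carrier to A)

  Matrix : ℕ → Set c
  Matrix n = Fin n → Fin n → A

  signVal : Sign → A
  signVal Sign.+ = 1#
  signVal Sign.- = - 1#

  diagPlusSigned : ∀ {n} (G : Graph n) → (Fin n → A) → Signing G → Matrix n
  diagPlusSigned G d s i j with i ≟ j
  ... | yes _ = d i
  ... | no  _ = if adj G i j then signVal (sgn s i j) else 0#

  -- Polynomials: coefficient lists, lowest degree first
  Poly : Set c
  Poly = List A

  _+ₚ_ : Poly → Poly → Poly
  [] +ₚ q = q
  (a ∷ p) +ₚ [] = a ∷ p
  (a ∷ p) +ₚ (b ∷ q) = (a + b) ∷ (p +ₚ q)

  _*ₚ_ : Poly → Poly → Poly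
  [] *ₚ q = []
  (a ∷ p) *ₚ q = map (a *_) q +ₚ (0# ∷ (p *ₚ q))

  -ₚ_ : Poly → Poly
  -ₚ p = map (-_) p

  coeff : Poly → ℕ → A
  coeff [] _ = 0#
  coeff (a ∷ p) zero = a
  coeff (a ∷ p) (suc j) = coeff p j

module Det {a : Level} {B : Set a}
           (_⊕_ _⊗_ : B → B → B) (⊖_ : B → B) (𝟘 𝟙 : B) where

  sumFin : ∀ n → (Fin n → B) → B
  sumFin zero f = 𝟘
  sumFin (suc n) f = f zero ⊕ sumFin n (λ j → f (suc j))

  altSum : ∀ n → (Fin n → B) → B
  altSum zero f = 𝟘
  altSum (suc n) f = f zero ⊕ (⊖ altSum n (λ j → f (suc j)))

  det : ∀ n → (Fin n → Fin n → B) → B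
  det zero M = 𝟙
  det (suc n) M =
    altSum (suc n) (λ j → M zero j ⊗ det n (λ r l → M (suc r) (punchIn j l)))

module _ {c ℓ : Level} (R : CommutativeRing c ℓ) where
  open CommutativeRing R renaming (Carrier to A)

  charPoly : ∀ n → Matrix R n → Poly R
  charPoly n M = Det.det (_+ₚ_ R) (_*ₚ_ R) (-ₚ_ R) [] (1# ∷ []) n entry
    where
      entry : Fin n → Fin n → Poly R
      entry i j with i ≟ j
      ... | yes _ = (- M i i) ∷ 1# ∷ []
      ... | no  _ = (- M i j) ∷ []

  negPow : ℕ → A → A
  negPow zero a = a
  negPow (suc i) a = - negPow i a

  -- e_i(λ(M)) expressed via Vieta: (-1)^i · [x^{n-i}] det(xI - M) for i ≤ n,
  -- and 0 for i > n (empty elementary symmetric sum).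
  eλ : ∀ n → Matrix R n → ℕ → A
  eλ n M i = if i ≤ᵇ n then negPow i (coeff R (charPoly n M) (n ∸ i)) else 0#

-- Expand det(xI - (D + A_s)) by the Leibniz formula: the term of a permutation π is
-- ± ∏_r (x [r = π r] - (D + A_s)(r, π r)), of degree at most the number of fixed points of π.
-- Passing from s₁ to s₂ multiplies the entry (u, v) by ε(u, v) = s₁(uv) s₂(uv) (and by 1 off
-- the edges), so the term of an involution π changes by ∏_r ε(r, π r), a product of squares of
-- ±1 over its 2-cycles. Any other π either uses a non-edge, so that its term vanishes, or has an
-- orbit of length ≥ 3 along edges of G. That orbit is a cycle, longer than k by the girth
-- hypothesis, so π fixes fewer than n - k points and its term cannot reach x^(n-i) for i ≤ k.

module Submission where

open import Defs
open import Data.Bool using (Bool; true; false; not; if_then_else_)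
import Data.Bool.Properties as Boolₚ
open import Data.Nat as ℕ using (ℕ; zero; suc; _∸_; _≤_; _<_; _≤ᵇ_; s≤s; z≤n)
import Data.Nat.Properties as ℕₚ
open import Data.Fin using (Fin; zero; suc; toℕ; punchIn; _≟_) renaming (_<_ to _<ᶠ_)
import Data.Fin.Properties as Finₚ
open import Data.Fin.Permutation as Perm using (Permutation′; _⟨$⟩ʳ_; _⟨$⟩ˡ_)
open import Data.List using ([]; _∷_; map)
open import Data.Product using (Σ; ∃; _×_; _,_; proj₁; proj₂)
open import Data.Sum using (_⊎_; inj₁; inj₂; [_,_]′)
import Data.Sign as Sign
open import Function using (_∘_)
open import Function.Definitions using (Injective)
open import Relation.Binary using (tri<; tri≈; tri>)
open import Relation.Binary.PropositionalEquality
  using (_≡_; _≢_; refl; sym; trans; cong; subst; subst₂; module ≡-Reasoning)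
open import Relation.Nullary using (¬_; yes; no; does)
open import Relation.Nullary.Decidable using (dec-true; dec-false; ¬?; _×-dec_)
open import Relation.Nullary.Negation using (contradiction)
open import Relation.Unary using (Decidable)
open import Algebra.Bundles using (CommutativeMonoid; CommutativeRing)

-- Fixed points, orbits and cycles

count : ∀ {n} → (Fin n → Bool) → ℕ
count {zero}  P = 0
count {suc n} P = if P zero then suc (count (P ∘ suc)) else count (P ∘ suc)

count+count-not : ∀ {n} (P : Fin n → Bool) → count P ℕ.+ count (not ∘ P) ≡ n
count+count-not {zero}  P = refl
count+count-not {suc n} P with P zero
... | true  = cong suc (count+count-not (P ∘ suc))
... | false = trans (ℕₚ.+-suc _ _) (cong suc (count+count-not (P ∘ suc)))

rank : ∀ {n} (P : Fin n → Bool) (x : Fin n) → P x ≡ true → Fin (count P)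
rank {suc n} P zero    Px with P zero
rank {suc n} P zero    refl | .true = zero
rank {suc n} P (suc x) Px with P zero
... | true  = suc (rank (P ∘ suc) x Px)
... | false = rank (P ∘ suc) x Px

rank-injective : ∀ {n} (P : Fin n → Bool) {x y} (Px : P x ≡ true) (Py : P y ≡ true) →
                 rank P x Px ≡ rank P y Py → x ≡ y
rank-injective {suc n} P {zero}  {zero}  Px   Py   eq = refl
rank-injective {suc n} P {zero}  {suc y} Px   Py   eq with P zero
rank-injective {suc n} P {zero}  {suc y} refl Py   () | .true
rank-injective {suc n} P {suc x} {zero}  Px   Py   eq with P zero
rank-injective {suc n} P {suc x} {zero}  Px   refl () | .true
rank-injective {suc n} P {suc x} {suc y} Px   Py   eq with P zero
... | true  = cong suc (rank-injective (P ∘ suc) Px Py (Finₚ.suc-injective eq))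
... | false = cong suc (rank-injective (P ∘ suc) Px Py eq)

injective⇒≤count : ∀ {L n} (P : Fin n → Bool) (v : Fin L → Fin n) → Injective _≡_ _≡_ v →
                   (∀ t → P (v t) ≡ true) → L ≤ count P
injective⇒≤count P v v-injective Pv =
  Finₚ.injective⇒≤ λ eq → v-injective (rank-injective P (Pv _) (Pv _) eq)

Least : ∀ {p} → (ℕ → Set p) → ℕ → Set p
Least P t = P t × (∀ {u} → u < t → ¬ P u)

module _ {p} {P : ℕ → Set p} (P? : Decidable P) where

  least-below : ∀ b → ∃ (Least P) ⊎ (∀ {u} → u < b → ¬ P u)
  least-below zero = inj₂ λ ()
  least-below (suc b) with least-below b
  ... | inj₁ found = inj₁ found
  ... | inj₂ none with P? b
  ...   | yes Pb = inj₁ (b , Pb , none)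
  ...   | no ¬Pb = inj₂ λ u<1+b →
    [ none , (λ { refl → ¬Pb }) ]′ (ℕₚ.m≤n⇒m<n∨m≡n (ℕ.s≤s⁻¹ u<1+b))

  least : ∀ {b} → P b → ∃ (Least P)
  least {b} Pb with least-below (suc b)
  ... | inj₁ found = found
  ... | inj₂ none  = contradiction Pb (none ℕₚ.≤-refl)

isFixed : ∀ {n} → (Fin n → Fin n) → Fin n → Bool
isFixed π r = does (r ≟ π r)

⟨$⟩ʳ-injective : ∀ {n} (π : Permutation′ n) → Injective _≡_ _≡_ (π ⟨$⟩ʳ_)
⟨$⟩ʳ-injective π {x} {y} eq =
  trans (sym (Perm.inverseˡ π)) (trans (cong (π ⟨$⟩ˡ_) eq) (Perm.inverseˡ π))

isFixed⇒≡ : ∀ {n} (π : Fin n → Fin n) {r} → isFixed π r ≡ true → r ≡ π r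
isFixed⇒≡ π {r} fixed with r ≟ π r
... | yes r≡πr = r≡πr
isFixed⇒≡ π {r} () | no _

module Orbit {n} (π : Fin n → Fin n) (π-injective : Injective _≡_ _≡_ π) where
  open import Data.Nat using (_+_)

  orbit : ℕ → Fin n → Fin n
  orbit zero    x = x
  orbit (suc t) x = π (orbit t x)

  orbit-+ : ∀ a b x → orbit (a + b) x ≡ orbit a (orbit b x)
  orbit-+ zero    b x = refl
  orbit-+ (suc a) b x = cong π (orbit-+ a b x)

  orbit-injective : ∀ t → Injective _≡_ _≡_ (orbit t)
  orbit-injective zero    eq = eq
  orbit-injective (suc t) eq = orbit-injective t (π-injective eq)

  orbit-repeat⇒period : ∀ {a b} x → a < b → orbit a x ≡ orbit b x →
                        ∃ λ d → suc d ≤ b × orbit (suc d) x ≡ x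
  orbit-repeat⇒period {a} x a<b eq with d , refl ← ℕₚ.m≤n⇒∃[o]m+o≡n a<b =
    d , s≤s (ℕₚ.m≤n+m d a) , sym (orbit-injective a (begin
      orbit a x                  ≡⟨ eq ⟩
      orbit (suc (a + d)) x      ≡⟨ cong (λ t → orbit t x) (ℕₚ.+-suc a d) ⟨
      orbit (a + suc d) x        ≡⟨ orbit-+ a (suc d) x ⟩
      orbit a (orbit (suc d) x)  ∎))
    where open ≡-Reasoning

  periodic : ∀ x → ∃ λ d → orbit (suc d) x ≡ x
  periodic x with i , j , i<j , eq ← Finₚ.pigeonhole (ℕₚ.n<1+n n) (λ t → orbit (toℕ t) x) =
    let d , _ , return = orbit-repeat⇒period x i<j eq in d , return

  module _ (G : Graph n) (along-edges : ∀ y → π y ≢ y → adj G y (π y) ≡ true)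
           (r : Fin n) (not-involutive : π (π r) ≢ r) where

    minimal-period : ∃ (Least λ p → orbit (suc p) r ≡ r)
    minimal-period = let d , return = periodic r in least (λ p → orbit (suc p) r ≟ r) {d} return

    p : ℕ
    p = proj₁ minimal-period

    r-moved : π r ≢ r
    r-moved eq = not-involutive (trans (cong π eq) eq)

    orbit-moved : ∀ a → π (orbit a r) ≢ orbit a r
    orbit-moved a eq = r-moved (orbit-injective a (begin
      orbit a (π r)    ≡⟨ orbit-+ a 1 r ⟨
      orbit (a + 1) r  ≡⟨ cong (λ t → orbit t r) (ℕₚ.+-comm a 1) ⟩
      π (orbit a r)    ≡⟨ eq ⟩
      orbit a r        ∎))
      where open ≡-Reasoning

    2≤p : 2 ≤ p
    2≤p with p | proj₁ (proj₂ minimal-period)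
    ... | 0           | return = contradiction return r-moved
    ... | 1           | return = contradiction return not-involutive
    ... | suc (suc _) | _      = s≤s (s≤s z≤n)

    orbit-distinct : ∀ {a b} → a < b → b ≤ p → orbit a r ≢ orbit b r
    orbit-distinct a<b b≤p eq =
      let d , 1+d≤b , return = orbit-repeat⇒period r a<b eq
      in proj₂ (proj₂ minimal-period) (ℕₚ.<-≤-trans 1+d≤b b≤p) return

    vertex : Fin (suc p) → Fin n
    vertex t = orbit (toℕ t) r

    vertex-injective : Injective _≡_ _≡_ vertex
    vertex-injective {x} {y} eq with ℕₚ.<-cmp (toℕ x) (toℕ y)
    ... | tri< x<y _ _ = contradiction eq (orbit-distinct x<y (Finₚ.toℕ≤pred[n] y))
    ... | tri≈ _ x≡y _ = Finₚ.toℕ-injective x≡y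
    ... | tri> _ _ y<x = contradiction (sym eq) (orbit-distinct y<x (Finₚ.toℕ≤pred[n] x))

    orbitCycle : Cycle G p
    orbitCycle = record
      { len≥3    = 2≤p
      ; vs       = vertex
      ; distinct = vertex-injective
      ; step     = λ i → subst (λ t → adj G (orbit t r) (vertex (suc i)) ≡ true)
                               (sym (Finₚ.toℕ-inject₁ i))
                               (along-edges _ (orbit-moved (toℕ i)))
      ; close    = subst₂ (λ t y → adj G (orbit t r) y ≡ true)
                          (sym (Finₚ.toℕ-fromℕ p)) (proj₁ (proj₂ minimal-period))
                          (along-edges _ (orbit-moved p))
      }

    count-fixed+k<n : ∀ {k} → GirthGreaterThan G k → count (isFixed π) + k < n
    count-fixed+k<n {k} girth>k = begin-strict
      c + k                        <⟨ ℕₚ.+-monoʳ-< c (girth>k p orbitCycle) ⟩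
      c + suc p                    ≤⟨ ℕₚ.+-monoʳ-≤ c cycle≤moved ⟩
      c + count (not ∘ isFixed π)  ≡⟨ count+count-not (isFixed π) ⟩
      n                            ∎
      where
        open ℕₚ.≤-Reasoning
        c = count (isFixed π)
        vertex-moved : ∀ t → not (isFixed π (vertex t)) ≡ true
        vertex-moved t = cong not (dec-false (vertex t ≟ π (vertex t)) (orbit-moved (toℕ t) ∘ sym))
        cycle≤moved : suc p ≤ count (not ∘ isFixed π)
        cycle≤moved = injective⇒≤count _ vertex vertex-injective vertex-moved

module _ {a ℓ} (M : CommutativeMonoid a ℓ) where
  open CommutativeMonoid M using (Carrier; _≈_; _∙_; ε; ∙-congˡ; identityˡ; identityʳ; setoid)
    renaming (sym to ≈-sym; trans to ≈-trans)
  open import Algebra.Properties.CommutativeMonoid.Sum M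
    using (sum; sum-cong-≋; sum-permute; ∑-distrib-+; sum-replicate-zero)
  open import Relation.Binary.Reasoning.Setoid setoid

  -- h keeps f only at the smaller point of each 2-cycle {r, π r}, so that f r ≈ h r ∙ h (π r).
  sum-involution≈ε : ∀ {n} (π : Fin n → Fin n) → (∀ r → π (π r) ≡ r) →
                     (f : Fin n → Carrier) → (∀ r → f (π r) ≈ f r) →
                     (∀ r → π r ≡ r → f r ≈ ε) → (∀ r → f r ∙ f r ≈ ε) →
                     sum f ≈ ε
  sum-involution≈ε {n} π π²≡id f f∘π≈f f-fixed f²≈ε = begin
    sum f                          ≈⟨ sum-cong-≋ f≈h∙h∘π ⟩
    sum (λ r → h r ∙ h (π r))      ≈⟨ ∑-distrib-+ h (h ∘ π) ⟩
    sum h ∙ sum (h ∘ π)            ≈⟨ ∙-congˡ (sum-permute h π-perm) ⟨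
    sum h ∙ sum h                  ≈⟨ ∑-distrib-+ h h ⟨
    sum (λ r → h r ∙ h r)          ≈⟨ sum-cong-≋ h²≈ε ⟩
    sum {n} (λ _ → ε)              ≈⟨ sum-replicate-zero n ⟩
    ε                              ∎
    where
      π-perm : Permutation′ n
      π-perm = Perm.permutation π π π²≡id π²≡id

      h : Fin n → Carrier
      h r = if does (r Finₚ.<? π r) then f r else ε

      h-below : ∀ {r} → r <ᶠ π r → h r ≡ f r
      h-below {r} r<πr rewrite dec-true (r Finₚ.<? π r) r<πr = refl

      h-above : ∀ {r} → ¬ (r <ᶠ π r) → h r ≡ ε
      h-above {r} r≮πr rewrite dec-false (r Finₚ.<? π r) r≮πr = refl

      h²≈ε : ∀ r → h r ∙ h r ≈ ε
      h²≈ε r with does (r Finₚ.<? π r)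
      ... | true  = f²≈ε r
      ... | false = identityˡ ε

      h-above-π : ∀ {r} → ¬ (π r <ᶠ r) → h (π r) ≡ ε
      h-above-π {r} πr≮r = h-above (πr≮r ∘ subst (π r <ᶠ_) (π²≡id r))

      h-below-π : ∀ {r} → π r <ᶠ r → h (π r) ≡ f (π r)
      h-below-π {r} πr<r = h-below (subst (π r <ᶠ_) (sym (π²≡id r)) πr<r)

      f≈h∙h∘π : ∀ r → f r ≈ h r ∙ h (π r)
      f≈h∙h∘π r with Finₚ.<-cmp r (π r)
      ... | tri< r<πr _ πr≮r rewrite h-below r<πr | h-above-π πr≮r = ≈-sym (identityʳ (f r))
      ... | tri≈ r≮πr r≡πr πr≮r rewrite h-above r≮πr | h-above-π πr≮r =
        ≈-trans (f-fixed r (sym r≡πr)) (≈-sym (identityˡ ε))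
      ... | tri> r≮πr _ πr<r rewrite h-above r≮πr | h-below-π πr<r =
        ≈-trans (≈-sym (f∘π≈f r)) (≈-sym (identityˡ (f (π r))))

-- Leibniz expansion of the characteristic polynomial

module _ {c ℓ} (R : CommutativeRing c ℓ) where
  open CommutativeRing R hiding (zero; refl; sym; trans) renaming (Carrier to A)
  open CommutativeRing R using () renaming (refl to ≈-refl; sym to ≈-sym; trans to ≈-trans)
  open import Algebra.Properties.Ring ring
    using (-0#≈0#; -‿distribʳ-*; -‿+-comm; -1*x≈-x; -‿involutive)
  open import Algebra.Properties.CommutativeMonoid.Sum *-commutativeMonoid
    using () renaming (sum to prod)
  open import Algebra.Properties.CommutativeSemigroup *-commutativeSemigroup using (interchange)
  open import Algebra.Properties.CommutativeSemigroup +-commutativeSemigroup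
    using () renaming (interchange to interchange⁺)
  open import Relation.Binary.Reasoning.Setoid setoid

  module PolyDet = Det (_+ₚ_ R) (_*ₚ_ R) (-ₚ_ R) [] (1# ∷ [])
  open Det _+_ _*_ -_ 0# 1# using (altSum)

  coeff-+ₚ : ∀ p q e → coeff R (_+ₚ_ R p q) e ≈ coeff R p e + coeff R q e
  coeff-+ₚ []      q       e       = ≈-sym (+-identityˡ _)
  coeff-+ₚ (a ∷ p) []      e       = ≈-sym (+-identityʳ _)
  coeff-+ₚ (a ∷ p) (b ∷ q) zero    = ≈-refl
  coeff-+ₚ (a ∷ p) (b ∷ q) (suc e) = coeff-+ₚ p q e

  coeff--ₚ : ∀ p e → coeff R (-ₚ_ R p) e ≈ - coeff R p e
  coeff--ₚ []      e       = ≈-sym -0#≈0#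
  coeff--ₚ (a ∷ p) zero    = ≈-refl
  coeff--ₚ (a ∷ p) (suc e) = coeff--ₚ p e

  coeff-map-* : ∀ x q e → coeff R (map (x *_) q) e ≈ x * coeff R q e
  coeff-map-* x []      e       = ≈-sym (zeroʳ x)
  coeff-map-* x (a ∷ q) zero    = ≈-refl
  coeff-map-* x (a ∷ q) (suc e) = coeff-map-* x q e

  -- On coefficient sequences ℕ → A, mulAffine a b multiplies by a + x if b and by a otherwise.
  affine : A → Bool → Poly R
  affine a false = a ∷ []
  affine a true  = a ∷ 1# ∷ []

  shiftIf : Bool → (ℕ → A) → ℕ → A
  shiftIf false g e       = 0#
  shiftIf true  g zero    = 0#
  shiftIf true  g (suc e) = g e

  mulAffine : A → Bool → (ℕ → A) → ℕ → A
  mulAffine a b g e = a * g e + shiftIf b g e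

  coeff-*ₚ-affine : ∀ a b q e → coeff R (_*ₚ_ R (affine a b) q) e ≈ mulAffine a b (coeff R q) e
  coeff-*ₚ-affine a false q e = begin
    coeff R (_+ₚ_ R (map (a *_) q) (0# ∷ [])) e    ≈⟨ coeff-+ₚ (map (a *_) q) _ e ⟩
    coeff R (map (a *_) q) e + coeff R (0# ∷ []) e ≈⟨ +-cong (coeff-map-* a q e) (coeff-0 e) ⟩
    a * coeff R q e + 0#                            ∎
    where
      coeff-0 : ∀ e → coeff R (0# ∷ []) e ≈ 0#
      coeff-0 zero    = ≈-refl
      coeff-0 (suc e) = ≈-refl
  coeff-*ₚ-affine a true q e = begin
    coeff R (_+ₚ_ R (map (a *_) q) (0# ∷ _*ₚ_ R (1# ∷ []) q)) e
      ≈⟨ coeff-+ₚ (map (a *_) q) _ e ⟩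
    coeff R (map (a *_) q) e + coeff R (0# ∷ _*ₚ_ R (1# ∷ []) q) e
      ≈⟨ +-cong (coeff-map-* a q e) (coeff-x* e) ⟩
    a * coeff R q e + shiftIf true (coeff R q) e ∎
    where
      coeff-x* : ∀ e → coeff R (0# ∷ _*ₚ_ R (1# ∷ []) q) e ≈ shiftIf true (coeff R q) e
      coeff-x* zero    = ≈-refl
      coeff-x* (suc e) =
        ≈-trans (coeff-*ₚ-affine 1# false q e) (≈-trans (+-identityʳ _) (*-identityˡ _))

  shiftIf-cong : ∀ b {g h : ℕ → A} → (∀ e → g e ≈ h e) →
                 ∀ e → shiftIf b g e ≈ shiftIf b h e
  shiftIf-cong false g≈h e       = ≈-refl
  shiftIf-cong true  g≈h zero    = ≈-refl
  shiftIf-cong true  g≈h (suc e) = g≈h e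

  shiftIf-0 : ∀ b {g : ℕ → A} → (∀ e → g e ≈ 0#) → ∀ e → shiftIf b g e ≈ 0#
  shiftIf-0 false g≈0 e       = ≈-refl
  shiftIf-0 true  g≈0 zero    = ≈-refl
  shiftIf-0 true  g≈0 (suc e) = g≈0 e

  mulAffine-cong : ∀ a b {g h : ℕ → A} → (∀ e → g e ≈ h e) →
                   ∀ e → mulAffine a b g e ≈ mulAffine a b h e
  mulAffine-cong a b g≈h e = +-cong (*-congˡ (g≈h e)) (shiftIf-cong b g≈h e)

  mulAffine-vanishes : ∀ a b g e → g e ≈ 0# → shiftIf b g e ≈ 0# → mulAffine a b g e ≈ 0#
  mulAffine-vanishes a b g e g≈0 shift≈0 = begin
    a * g e + shiftIf b g e ≈⟨ +-cong (*-congˡ g≈0) shift≈0 ⟩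
    a * 0# + 0#             ≈⟨ +-identityʳ _ ⟩
    a * 0#                  ≈⟨ zeroʳ a ⟩
    0#                      ∎

  mulAffine-* : ∀ ε a b x (g : ℕ → A) e → (b ≡ true → ε ≈ 1#) →
                mulAffine (ε * a) b (λ e → x * g e) e ≈ (ε * x) * mulAffine a b g e
  mulAffine-* ε a b x g e ε≈1 = begin
    (ε * a) * (x * g e) + shiftIf b (λ e → x * g e) e
      ≈⟨ +-cong (interchange ε a x (g e)) (scaled-shift b e ε≈1) ⟩
    (ε * x) * (a * g e) + (ε * x) * shiftIf b g e
      ≈⟨ distribˡ (ε * x) _ _ ⟨
    (ε * x) * mulAffine a b g e ∎
    where
      scaled-shift : ∀ b e → (b ≡ true → ε ≈ 1#) →
                     shiftIf b (λ e → x * g e) e ≈ (ε * x) * shiftIf b g e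
      scaled-shift false e       _   = ≈-sym (zeroʳ _)
      scaled-shift true  zero    _   = ≈-sym (zeroʳ _)
      scaled-shift true  (suc e) ε≈1 =
        *-congʳ (≈-sym (≈-trans (*-congʳ (ε≈1 refl)) (*-identityˡ x)))

  coeff-altSum : ∀ m (f : Fin m → Poly R) e →
                 coeff R (PolyDet.altSum m f) e ≈ altSum m (λ j → coeff R (f j) e)
  coeff-altSum zero    f e = ≈-refl
  coeff-altSum (suc m) f e = begin
    coeff R (_+ₚ_ R (f zero) (-ₚ_ R (PolyDet.altSum m (f ∘ suc)))) e
      ≈⟨ coeff-+ₚ (f zero) _ e ⟩
    coeff R (f zero) e + coeff R (-ₚ_ R (PolyDet.altSum m (f ∘ suc))) e
      ≈⟨ +-congˡ (coeff--ₚ (PolyDet.altSum m (f ∘ suc)) e) ⟩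
    coeff R (f zero) e + - coeff R (PolyDet.altSum m (f ∘ suc)) e
      ≈⟨ +-congˡ (-‿cong (coeff-altSum m (f ∘ suc) e)) ⟩
    altSum (suc m) (λ j → coeff R (f j) e) ∎

  altSum-cong : ∀ m {f g : Fin m → A} → (∀ j → f j ≈ g j) → altSum m f ≈ altSum m g
  altSum-cong zero    f≈g = ≈-refl
  altSum-cong (suc m) f≈g = +-cong (f≈g zero) (-‿cong (altSum-cong m (f≈g ∘ suc)))

  altSum-0 : ∀ m → altSum m (λ _ → 0#) ≈ 0#
  altSum-0 zero    = ≈-refl
  altSum-0 (suc m) = ≈-trans (+-congˡ (≈-trans (-‿cong (altSum-0 m)) -0#≈0#)) (+-identityʳ 0#)

  altSum-+ : ∀ m (f g : Fin m → A) → altSum m (λ j → f j + g j) ≈ altSum m f + altSum m g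
  altSum-+ zero    f g = ≈-sym (+-identityˡ 0#)
  altSum-+ (suc m) f g = begin
    (f zero + g zero) + - altSum m (λ j → f (suc j) + g (suc j))
      ≈⟨ +-congˡ (-‿cong (altSum-+ m (f ∘ suc) (g ∘ suc))) ⟩
    (f zero + g zero) + - (altSum m (f ∘ suc) + altSum m (g ∘ suc))
      ≈⟨ +-congˡ (-‿+-comm _ _) ⟨
    (f zero + g zero) + (- altSum m (f ∘ suc) + - altSum m (g ∘ suc))
      ≈⟨ interchange⁺ _ _ _ _ ⟩
    altSum (suc m) f + altSum (suc m) g ∎

  altSum-* : ∀ m x (f : Fin m → A) → altSum m (λ j → x * f j) ≈ x * altSum m f
  altSum-* zero    x f = ≈-sym (zeroʳ x)
  altSum-* (suc m) x f = begin
    x * f zero + - altSum m (λ j → x * f (suc j)) ≈⟨ +-congˡ (-‿cong (altSum-* m x (f ∘ suc))) ⟩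
    x * f zero + - (x * altSum m (f ∘ suc))       ≈⟨ +-congˡ (-‿distribʳ-* x _) ⟩
    x * f zero + x * - altSum m (f ∘ suc)         ≈⟨ distribˡ x _ _ ⟨
    x * altSum (suc m) f                          ∎

  -- Σ_π sgn(π) F(π): every permutation of Fin (suc m) is insert zero j π for unique j and π,
  -- and has sign (-1)^j sgn(π), exactly as in Laplace expansion along the first row.
  leibnizSum : ∀ m → (Permutation′ m → A) → A
  leibnizRow : ∀ m → (Permutation′ (suc m) → A) → Fin (suc m) → A

  leibnizSum zero    F = F Perm.id
  leibnizSum (suc m) F = altSum (suc m) (leibnizRow m F)

  leibnizRow m F j = leibnizSum m (F ∘ Perm.insert zero j)

  leibnizSum-cong : ∀ m {F G : Permutation′ m → A} → (∀ π → F π ≈ G π) →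
                    leibnizSum m F ≈ leibnizSum m G
  leibnizSum-cong zero    F≈G = F≈G Perm.id
  leibnizSum-cong (suc m) F≈G =
    altSum-cong (suc m) (λ j → leibnizSum-cong m (F≈G ∘ Perm.insert zero j))

  leibnizSum-0 : ∀ m → leibnizSum m (λ _ → 0#) ≈ 0#
  leibnizSum-0 zero    = ≈-refl
  leibnizSum-0 (suc m) = ≈-trans (altSum-cong (suc m) (λ _ → leibnizSum-0 m)) (altSum-0 (suc m))

  leibnizSum-+ : ∀ m (F G : Permutation′ m → A) →
                 leibnizSum m (λ π → F π + G π) ≈ leibnizSum m F + leibnizSum m G
  leibnizSum-+ zero    F G = ≈-refl
  leibnizSum-+ (suc m) F G = ≈-trans
    (altSum-cong (suc m) (λ j → leibnizSum-+ m (F ∘ Perm.insert zero j) (G ∘ Perm.insert zero j)))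
    (altSum-+ (suc m) (leibnizRow m F) (leibnizRow m G))

  leibnizSum-* : ∀ m x (F : Permutation′ m → A) →
                 leibnizSum m (λ π → x * F π) ≈ x * leibnizSum m F
  leibnizSum-* zero    x F = ≈-refl
  leibnizSum-* (suc m) x F = ≈-trans
    (altSum-cong (suc m) (λ j → leibnizSum-* m x (F ∘ Perm.insert zero j)))
    (altSum-* (suc m) x (leibnizRow m F))

  shiftIf-leibnizSum : ∀ m b (G : ℕ → Permutation′ m → A) e →
                       shiftIf b (λ e → leibnizSum m (G e)) e ≈
                       leibnizSum m (λ π → shiftIf b (λ e → G e π) e)
  shiftIf-leibnizSum m false G e       = ≈-sym (leibnizSum-0 m)
  shiftIf-leibnizSum m true  G zero    = ≈-sym (leibnizSum-0 m)
  shiftIf-leibnizSum m true  G (suc e) = ≈-refl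

  mulAffine-leibnizSum : ∀ m a b (G : ℕ → Permutation′ m → A) e →
                         mulAffine a b (λ e → leibnizSum m (G e)) e ≈
                         leibnizSum m (λ π → mulAffine a b (λ e → G e π) e)
  mulAffine-leibnizSum m a b G e = begin
    a * leibnizSum m (G e) + shiftIf b (λ e → leibnizSum m (G e)) e
      ≈⟨ +-cong (≈-sym (leibnizSum-* m a (G e))) (shiftIf-leibnizSum m b G e) ⟩
    leibnizSum m (λ π → a * G e π) + leibnizSum m (λ π → shiftIf b (λ e → G e π) e)
      ≈⟨ leibnizSum-+ m _ _ ⟨
    leibnizSum m (λ π → mulAffine a b (λ e → G e π) e) ∎

  prodAffine : ∀ m → (Fin m → A) → (Fin m → Bool) → ℕ → A
  prodAffine zero    a δ zero    = 1#
  prodAffine zero    a δ (suc e) = 0#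
  prodAffine (suc m) a δ         = mulAffine (a zero) (δ zero) (prodAffine m (a ∘ suc) (δ ∘ suc))

  coeff-det-affine : ∀ m (E : Fin m → Fin m → Poly R) (C : Fin m → Fin m → A)
                     (Δ : Fin m → Fin m → Bool) → (∀ i j → E i j ≡ affine (C i j) (Δ i j)) →
                     ∀ e → coeff R (PolyDet.det m E) e ≈
                           leibnizSum m (λ π → prodAffine m (λ r → C r (π ⟨$⟩ʳ r))
                                                            (λ r → Δ r (π ⟨$⟩ʳ r)) e)
  coeff-det-affine zero    E C Δ E≡ zero    = ≈-refl
  coeff-det-affine zero    E C Δ E≡ (suc e) = ≈-refl
  coeff-det-affine (suc m) E C Δ E≡ e =
    ≈-trans (coeff-altSum (suc m) (λ j → _*ₚ_ R (E zero j) (PolyDet.det m (minor j))) e)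
            (altSum-cong (suc m) expand)
    where
      minor : Fin (suc m) → Fin m → Fin m → Poly R
      minor j r l = E (suc r) (punchIn j l)

      expand : ∀ j → coeff R (_*ₚ_ R (E zero j) (PolyDet.det m (minor j))) e ≈
                     leibnizRow m (λ π → prodAffine (suc m) (λ r → C r (π ⟨$⟩ʳ r))
                                                            (λ r → Δ r (π ⟨$⟩ʳ r)) e) j
      expand j rewrite E≡ zero j = begin
        coeff R (_*ₚ_ R (affine (C zero j) (Δ zero j)) (PolyDet.det m (minor j))) e
          ≈⟨ coeff-*ₚ-affine (C zero j) (Δ zero j) _ e ⟩
        mulAffine (C zero j) (Δ zero j) (coeff R (PolyDet.det m (minor j))) e
          ≈⟨ mulAffine-cong (C zero j) (Δ zero j)
               (coeff-det-affine m (minor j) (λ r l → C (suc r) (punchIn j l))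
                  (λ r l → Δ (suc r) (punchIn j l)) (λ r l → E≡ (suc r) (punchIn j l))) e ⟩
        mulAffine (C zero j) (Δ zero j) (λ e → leibnizSum m (λ π → prodAffine m (C′ π) (Δ′ π) e)) e
          ≈⟨ mulAffine-leibnizSum m (C zero j) (Δ zero j) (λ e π → prodAffine m (C′ π) (Δ′ π) e) e ⟩
        leibnizSum m (λ π → mulAffine (C zero j) (Δ zero j) (prodAffine m (C′ π) (Δ′ π)) e) ∎
        where
          C′ : Permutation′ m → Fin m → A
          C′ π r = C (suc r) (punchIn j (π ⟨$⟩ʳ r))
          Δ′ : Permutation′ m → Fin m → Bool
          Δ′ π r = Δ (suc r) (punchIn j (π ⟨$⟩ʳ r))

  prodAffine-cong : ∀ m {a b : Fin m → A} δ → (∀ r → a r ≈ b r) →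
                    ∀ e → prodAffine m a δ e ≈ prodAffine m b δ e
  prodAffine-cong zero    δ a≈b zero    = ≈-refl
  prodAffine-cong zero    δ a≈b (suc e) = ≈-refl
  prodAffine-cong (suc m) δ a≈b e       = +-cong
    (*-cong (a≈b zero) (prodAffine-cong m (δ ∘ suc) (a≈b ∘ suc) e))
    (shiftIf-cong (δ zero) (prodAffine-cong m (δ ∘ suc) (a≈b ∘ suc)) e)

  prodAffine-vanishes : ∀ m a δ (y : Fin m) → a y ≈ 0# → δ y ≡ false →
                        ∀ e → prodAffine m a δ e ≈ 0#
  prodAffine-vanishes (suc m) a δ zero a₀≈0 δ₀≡false e rewrite δ₀≡false = begin
    a zero * prodAffine m (a ∘ suc) (δ ∘ suc) e + 0#  ≈⟨ +-identityʳ _ ⟩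
    a zero * prodAffine m (a ∘ suc) (δ ∘ suc) e       ≈⟨ *-congʳ a₀≈0 ⟩
    0# * prodAffine m (a ∘ suc) (δ ∘ suc) e           ≈⟨ zeroˡ _ ⟩
    0#                                                ∎
  prodAffine-vanishes (suc m) a δ (suc y) aᵧ≈0 δᵧ≡false e =
    mulAffine-vanishes (a zero) (δ zero) (prodAffine m (a ∘ suc) (δ ∘ suc)) e
      (rest≈0 e) (shiftIf-0 (δ zero) rest≈0 e)
    where
      rest≈0 : ∀ e → prodAffine m (a ∘ suc) (δ ∘ suc) e ≈ 0#
      rest≈0 = prodAffine-vanishes m (a ∘ suc) (δ ∘ suc) y aᵧ≈0 δᵧ≡false

  prodAffine-deg : ∀ m a δ e → count δ < e → prodAffine m a δ e ≈ 0#
  prodAffine-deg zero    a δ (suc e) _  = ≈-refl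
  prodAffine-deg (suc m) a δ e       δ<e with δ zero
  ... | false = mulAffine-vanishes (a zero) false (prodAffine m (a ∘ suc) (δ ∘ suc)) e
                  (prodAffine-deg m (a ∘ suc) (δ ∘ suc) e δ<e) ≈-refl
  prodAffine-deg (suc m) a δ (suc e) (s≤s δ<e) | true =
    mulAffine-vanishes (a zero) true (prodAffine m (a ∘ suc) (δ ∘ suc)) (suc e)
      (prodAffine-deg m (a ∘ suc) (δ ∘ suc) (suc e) (ℕₚ.m≤n⇒m≤1+n δ<e))
      (prodAffine-deg m (a ∘ suc) (δ ∘ suc) e δ<e)

  prodAffine-* : ∀ m (ε a : Fin m → A) δ → (∀ r → δ r ≡ true → ε r ≈ 1#) →
                 ∀ e → prodAffine m (λ r → ε r * a r) δ e ≈ prod ε * prodAffine m a δ e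
  prodAffine-* zero    ε a δ _   zero    = ≈-sym (*-identityˡ 1#)
  prodAffine-* zero    ε a δ _   (suc e) = ≈-sym (zeroʳ 1#)
  prodAffine-* (suc m) ε a δ ε≈1 e       = begin
    mulAffine (ε zero * a zero) (δ zero) (prodAffine m (λ r → ε (suc r) * a (suc r)) (δ ∘ suc)) e
      ≈⟨ mulAffine-cong (ε zero * a zero) (δ zero)
           (prodAffine-* m (ε ∘ suc) (a ∘ suc) (δ ∘ suc) (ε≈1 ∘ suc)) e ⟩
    mulAffine (ε zero * a zero) (δ zero) (λ e → prod (ε ∘ suc) * prodAffine m (a ∘ suc) (δ ∘ suc) e) e
      ≈⟨ mulAffine-* (ε zero) (a zero) (δ zero) (prod (ε ∘ suc)) _ e (ε≈1 zero) ⟩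
    prod ε * prodAffine (suc m) a δ e ∎

  -- Names the entries of det(xI - M), which Defs defines in a where block.
  charPoly-entries : ∀ n (M : Matrix R n) →
                     Σ (Fin n → Fin n → Poly R) λ E → charPoly R n M ≡ PolyDet.det n E
  charPoly-entries n M = _ , refl

  charPoly-entry : ∀ n (M : Matrix R n) i j →
                   proj₁ (charPoly-entries n M) i j ≡ affine (- M i j) (does (i ≟ j))
  charPoly-entry n M i j with i ≟ j
  ... | yes refl = refl
  ... | no  _ = refl

  leibnizTerm : ∀ n → Matrix R n → Permutation′ n → ℕ → A
  leibnizTerm n M π = prodAffine n (λ r → - M r (π ⟨$⟩ʳ r)) (isFixed (π ⟨$⟩ʳ_))

  coeff-charPoly : ∀ n (M : Matrix R n) e →
                   coeff R (charPoly R n M) e ≈ leibnizSum n (λ π → leibnizTerm n M π e)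
  coeff-charPoly n M = coeff-det-affine n (proj₁ (charPoly-entries n M))
                         (λ i j → - M i j) (λ i j → does (i ≟ j)) (charPoly-entry n M)

  negPow-cong : ∀ i {x y} → x ≈ y → negPow R i x ≈ negPow R i y
  negPow-cong zero    x≈y = x≈y
  negPow-cong (suc i) x≈y = -‿cong (negPow-cong i x≈y)

  eλ-cong : ∀ n (M N : Matrix R n) i →
            coeff R (charPoly R n M) (n ∸ i) ≈ coeff R (charPoly R n N) (n ∸ i) →
            eλ R n M i ≈ eλ R n N i
  eλ-cong n M N i coeff≈ with i ≤ᵇ n
  ... | true  = negPow-cong i coeff≈
  ... | false = ≈-refl

  leibnizTerm-involution : ∀ n (M N : Matrix R n) (ε : Fin n → Fin n → A) →
                           (∀ u v → N u v ≈ ε u v * M u v) → (∀ u v → ε u v ≈ ε v u) →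
                           (∀ v → ε v v ≈ 1#) → (∀ u v → ε u v * ε u v ≈ 1#) →
                           (π : Permutation′ n) → (∀ r → π ⟨$⟩ʳ (π ⟨$⟩ʳ r) ≡ r) →
                           ∀ e → leibnizTerm n N π e ≈ leibnizTerm n M π e
  leibnizTerm-involution n M N ε N≈εM ε-sym ε-diag ε² π π²≡id e = begin
    leibnizTerm n N π e
      ≈⟨ prodAffine-cong n (isFixed σ)
           (λ r → ≈-trans (-‿cong (N≈εM r (σ r))) (-‿distribʳ-* _ _)) e ⟩
    prodAffine n (λ r → ε r (σ r) * - M r (σ r)) (isFixed σ) e
      ≈⟨ prodAffine-* n (λ r → ε r (σ r)) _ (isFixed σ) ε-on-fixed e ⟩
    prod (λ r → ε r (σ r)) * leibnizTerm n M π e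
      ≈⟨ *-congʳ prod≈1 ⟩
    1# * leibnizTerm n M π e
      ≈⟨ *-identityˡ _ ⟩
    leibnizTerm n M π e ∎
    where
      σ : Fin n → Fin n
      σ = π ⟨$⟩ʳ_

      ε-on-fixed : ∀ r → isFixed σ r ≡ true → ε r (σ r) ≈ 1#
      ε-on-fixed r fixed = subst (λ x → ε r x ≈ 1#) (isFixed⇒≡ σ fixed) (ε-diag r)

      prod≈1 : prod (λ r → ε r (σ r)) ≈ 1#
      prod≈1 = sum-involution≈ε *-commutativeMonoid σ π²≡id (λ r → ε r (σ r))
        (λ r → subst (λ x → ε (σ r) x ≈ ε r (σ r)) (sym (π²≡id r)) (ε-sym (σ r) r))
        (λ r σr≡r → subst (λ x → ε r x ≈ 1#) (sym σr≡r) (ε-diag r))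
        (λ r → ε² r (σ r))

  -- Switching between signings

  signVal² : ∀ σ → signVal R σ * signVal R σ ≈ 1#
  signVal² Sign.+ = *-identityˡ 1#
  signVal² Sign.- = ≈-trans (-1*x≈-x (- 1#)) (-‿involutive 1#)

  module _ {n} (G : Graph n) (d : Fin n → A) where

    diagPlusSigned-off-edge : ∀ s {u v} → u ≢ v → adj G u v ≡ false →
                              diagPlusSigned R G d s u v ≡ 0#
    diagPlusSigned-off-edge s {u} {v} u≢v non-edge with u ≟ v
    ... | yes u≡v = contradiction u≡v u≢v
    ... | no  _   rewrite non-edge = refl

    leibnizTerm-vanishes : ∀ {k i} → GirthGreaterThan G k → i ≤ k → ∀ s (π : Permutation′ n) →
                           ¬ (∀ r → π ⟨$⟩ʳ (π ⟨$⟩ʳ r) ≡ r) →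
                           leibnizTerm n (diagPlusSigned R G d s) π (n ∸ i) ≈ 0#
    leibnizTerm-vanishes {k} {i} girth>k i≤k s π not-involution
      with Finₚ.any? (λ y → ¬? (π ⟨$⟩ʳ y ≟ y) ×-dec (adj G y (π ⟨$⟩ʳ y) Boolₚ.≟ false))
    ... | yes (y , y-moved , non-edge) =
      prodAffine-vanishes n _ _ y
        (≈-trans (-‿cong (reflexive (diagPlusSigned-off-edge s (y-moved ∘ sym) non-edge))) -0#≈0#)
        (dec-false (y ≟ π ⟨$⟩ʳ y) (y-moved ∘ sym)) (n ∸ i)
    ... | no no-moved-non-edge = prodAffine-deg n _ _ (n ∸ i) fixed<n∸i
      where
        along-edges : ∀ y → π ⟨$⟩ʳ y ≢ y → adj G y (π ⟨$⟩ʳ y) ≡ true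
        along-edges y y-moved = Boolₚ.¬-not λ non-edge → no-moved-non-edge (y , y-moved , non-edge)

        non-involutive-point : ∃ λ r → π ⟨$⟩ʳ (π ⟨$⟩ʳ r) ≢ r
        non-involutive-point = Finₚ.¬∀⟶∃¬ n _ (λ r → π ⟨$⟩ʳ (π ⟨$⟩ʳ r) ≟ r) not-involution

        #fixed : ℕ
        #fixed = count (isFixed (π ⟨$⟩ʳ_))

        #fixed+k<n : #fixed ℕ.+ k < n
        #fixed+k<n = Orbit.count-fixed+k<n (π ⟨$⟩ʳ_) (⟨$⟩ʳ-injective π) G along-edges
                  (proj₁ non-involutive-point) (proj₂ non-involutive-point) girth>k

        fixed<n∸i : #fixed < n ∸ i
        fixed<n∸i = ℕₚ.m+n≤o⇒m≤o∸n (suc #fixed)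
                      (ℕₚ.≤-trans (s≤s (ℕₚ.+-monoʳ-≤ #fixed i≤k)) #fixed+k<n)

    module _ (s₁ s₂ : Signing G) where

      switching : Fin n → Fin n → A
      switching u v = if adj G u v then signVal R (sgn s₁ u v) * signVal R (sgn s₂ u v) else 1#

      switching-sym : ∀ u v → switching u v ≈ switching v u
      switching-sym u v rewrite adj-sym G u v | sgn-sym s₁ u v | sgn-sym s₂ u v = ≈-refl

      switching-diag : ∀ v → switching v v ≈ 1#
      switching-diag v rewrite irrefl G v = ≈-refl

      switching² : ∀ u v → switching u v * switching u v ≈ 1#
      switching² u v with adj G u v
      ... | true  = ≈-trans (interchange _ _ _ _)
        (≈-trans (*-cong (signVal² (sgn s₁ u v)) (signVal² (sgn s₂ u v))) (*-identityˡ 1#))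
      ... | false = *-identityˡ 1#

      diagPlusSigned-switching : ∀ u v →
        diagPlusSigned R G d s₂ u v ≈ switching u v * diagPlusSigned R G d s₁ u v
      diagPlusSigned-switching u v with u ≟ v
      ... | yes refl = ≈-trans (≈-sym (*-identityˡ (d u))) (*-congʳ (≈-sym (switching-diag u)))
      ... | no  _ with adj G u v
      ...   | false = ≈-sym (*-identityˡ 0#)
      ...   | true  = ≈-sym (begin
        (σ₁ * σ₂) * σ₁ ≈⟨ *-congʳ (*-comm σ₁ σ₂) ⟩
        (σ₂ * σ₁) * σ₁ ≈⟨ *-assoc σ₂ σ₁ σ₁ ⟩
        σ₂ * (σ₁ * σ₁) ≈⟨ *-congˡ (signVal² (sgn s₁ u v)) ⟩
        σ₂ * 1#        ≈⟨ *-identityʳ σ₂ ⟩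
        σ₂             ∎)
        where
          σ₁ σ₂ : A
          σ₁ = signVal R (sgn s₁ u v)
          σ₂ = signVal R (sgn s₂ u v)

      leibnizTerm-signing-invariant : ∀ {k i} → GirthGreaterThan G k → i ≤ k → ∀ π →
        leibnizTerm n (diagPlusSigned R G d s₁) π (n ∸ i) ≈
        leibnizTerm n (diagPlusSigned R G d s₂) π (n ∸ i)
      leibnizTerm-signing-invariant {k} {i} girth>k i≤k π
        with Finₚ.all? (λ r → π ⟨$⟩ʳ (π ⟨$⟩ʳ r) ≟ r)
      ... | yes involution = ≈-sym (leibnizTerm-involution n _ _ switching diagPlusSigned-switching
                                      switching-sym switching-diag switching² π involution (n ∸ i))
      ... | no not-involution = ≈-trans (leibnizTerm-vanishes girth>k i≤k s₁ π not-involution)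
                                        (≈-sym (leibnizTerm-vanishes girth>k i≤k s₂ π not-involution))

lemma3p9 : ∀ {c ℓ} (R : CommutativeRing c ℓ) (n : ℕ) (G : Graph n)
               (d : Fin n → CommutativeRing.Carrier R) (k : ℕ) → 1 ≤ k →
               GirthGreaterThan G k → (s₁ s₂ : Signing G) → (i : ℕ) → 1 ≤ i → i ≤ k →
               CommutativeRing._≈_ R (eλ R n (diagPlusSigned R G d s₁) i)
                                    (eλ R n (diagPlusSigned R G d s₂) i)
lemma3p9 R n G d k _ girth>k s₁ s₂ i _ i≤k = eλ-cong R n M₁ M₂ i (begin
  coeff R (charPoly R n M₁) (n ∸ i)                ≈⟨ coeff-charPoly R n M₁ (n ∸ i) ⟩
  leibnizSum R n (λ π → leibnizTerm R n M₁ π (n ∸ i))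
    ≈⟨ leibnizSum-cong R n (leibnizTerm-signing-invariant R G d s₁ s₂ girth>k i≤k) ⟩
  leibnizSum R n (λ π → leibnizTerm R n M₂ π (n ∸ i)) ≈⟨ coeff-charPoly R n M₂ (n ∸ i) ⟨
  coeff R (charPoly R n M₂) (n ∸ i)                ∎)
  where
    open CommutativeRing R using (setoid)
    open import Relation.Binary.Reasoning.Setoid setoid
    M₁ = diagPlusSigned R G d s₁
    M₂ = diagPlusSigned R G d s₂
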